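{- Let $r$, $s$, $c$ and $a_n$ be any integers with $V_r\neq0$, and let $n$ be a positive integer. Then \[ \sum_{a_{n-1}=c}^{a_n}\sum_{a_{n-2}=c}^{a_{n-1}}\cdots\sum_{a_0=c}^{a_1}\frac{W_{ra_0+s}}{V_r^{a_0}} =(-1)^n\frac{W_{r(a_n+2n)+s}}{q^{rn}V_r^{a_n}}-\frac{1}{V_r^{c-1}}\sum_{j=0}^{n-1}(-1)^{n-j}\frac{W_{r(2n-2j+c-1)+s}}{q^{r(n-j)}}\binom{a_n+j-c}{j}. \]
   Context: Let $a,b,p,q$ be complex numbers with $p\neq0$, $q\neq0$. The Horadam sequence $W_j=W_j(a,b;p,q)$ is defined by $W_0=a$, $W_1=b$, $W_j=pW_{j-1}-qW_{j-2}$ for $j\ge2$, and extended to negative indices by $W_{j}=(pW_{j+1}-W_{j+2})/q$, so the recurrence holds for all integers $j$. $V_j=W_j(2,p;p,q)$ is the Lucas sequence of the second kind (same $p,q$). The left side is an iterated sum with $n$ summation signs: $a_{n-1}$ runs from $c$ to $a_n$, and for each $i$ the index $a_{i-1}$ runs from $c$ to $a_i$. Summation convention: for integers $m,M$, $\sum_{k=m}^{M}h(k)$ is the usual sum if $M\ge m$, equals $0$ if $M=m-1$, and equals $-\sum_{k=M+1}^{m-1}h(k)$ if $M\le m-2$. For an integer $N$ and a non-negative integer $j$, $\binom{N}{j}=N(N-1)\cdots(N-j+1)/j!$. -}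

module Defs where

open import Level using (Level; _⊔_; suc)
open import Algebra.Bundles using (CommutativeRing)
open import Data.Nat using (ℕ; zero; _!)
import Data.Nat as ℕ
open import Data.Nat.Properties using (_!≢0)
open import Data.Integer using (ℤ; +_; -[1+_])
import Data.Integer as ℤ
open import Data.Integer.DivMod using (_/ℕ_)
open import Data.Product using (_×_; _,_; proj₁)
open import Relation.Nullary using (¬_)

-- A field: a commutative ring with 1 ≠ 0 and a (total) inverse operation
-- that is a genuine inverse on all nonzero elements (value at 0 irrelevant).
record Field (c ℓ : Level) : Set (Level.suc (c ⊔ ℓ)) where
  field
    commutativeRing : CommutativeRing c ℓ
  open CommutativeRing commutativeRing public
  field
    _⁻¹      : Carrier → Carrier
    ⁻¹-cong  : ∀ {x y} → x ≈ y → x ⁻¹ ≈ y ⁻¹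
    1≉0      : ¬ (1# ≈ 0#)
    inverseʳ : ∀ x → ¬ (x ≈ 0#) → (x * x ⁻¹) ≈ 1#

module FieldDefs {c ℓ} (F : Field c ℓ) where
  open Field F

  infixl 7 _/_
  _/_ : Carrier → Carrier → Carrier
  x / y = x * y ⁻¹

  _^ⁿ_ : Carrier → ℕ → Carrier
  x ^ⁿ zero    = 1#
  x ^ⁿ ℕ.suc n = x * (x ^ⁿ n)

  _^ᶻ_ : Carrier → ℤ → Carrier
  x ^ᶻ (+ n)     = x ^ⁿ n
  x ^ᶻ -[1+ n ]  = (x ⁻¹) ^ⁿ ℕ.suc n

  fromℕ : ℕ → Carrier
  fromℕ zero      = 0#
  fromℕ (ℕ.suc n) = 1# + fromℕ n

  fromℤ : ℤ → Carrier
  fromℤ (+ n)    = fromℕ n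
  fromℤ -[1+ n ] = - fromℕ (ℕ.suc n)

  -- Horadam sequence W_j(a,b;p,q) for all integers j.
  -- forward: (W_n , W_{n+1});  backward: (W_{-n} , W_{-n+1}),
  -- using W_j = (p W_{j+1} - W_{j+2}) / q.
  private
    fwd : Carrier → Carrier → Carrier → Carrier → ℕ → Carrier × Carrier
    fwd a b p q zero = a , b
    fwd a b p q (ℕ.suc n) with fwd a b p q n
    ... | x , y = y , (p * y - q * x)

    bwd : Carrier → Carrier → Carrier → Carrier → ℕ → Carrier × Carrier
    bwd a b p q zero = a , b
    bwd a b p q (ℕ.suc n) with bwd a b p q n
    ... | x , y = ((p * x - y) / q) , x

  W : Carrier → Carrier → Carrier → Carrier → ℤ → Carrier
  W a b p q (+ n)    = proj₁ (fwd a b p q n)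
  W a b p q -[1+ n ] = proj₁ (bwd a b p q (ℕ.suc n))

  V : Carrier → Carrier → ℤ → Carrier
  V p q = W (1# + 1#) p p q

  sumℕ : ℕ → (ℕ → Carrier) → Carrier
  sumℕ zero      f = 0#
  sumℕ (ℕ.suc n) f = sumℕ n f + f n

  -- Σ_{k=m}^{M} h(k) with the paper's convention:
  -- usual sum if M ≥ m, 0 if M = m-1, -Σ_{k=M+1}^{m-1} h(k) if M ≤ m-2.
  sumℤ : ℤ → ℤ → (ℤ → Carrier) → Carrier
  sumℤ m M h with M ℤ.- m ℤ.+ ℤ.1ℤ
  ... | + n      = sumℕ n (λ i → h (m ℤ.+ + i))
  ... | -[1+ n ] = - sumℕ (ℕ.suc n) (λ i → h (M ℤ.+ ℤ.1ℤ ℤ.+ + i))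

  iterSum : ℤ → ℕ → (ℤ → Carrier) → ℤ → Carrier
  iterSum c zero      f x = f x
  iterSum c (ℕ.suc n) f x = sumℤ c x (λ y → iterSum c n f y)

-- binomial coefficient for an integer N and j ∈ ℕ:
-- N(N-1)⋯(N-j+1) / j!  (exact division in ℤ)
fallingℤ : ℤ → ℕ → ℤ
fallingℤ N zero      = ℤ.1ℤ
fallingℤ N (ℕ.suc j) = fallingℤ N j ℤ.* (N ℤ.- + j)

binomℤ : ℤ → ℕ → ℤ
binomℤ N j = _/ℕ_ (fallingℤ N j) (j !) {{j !≢0}}

{-# OPTIONS --safe #-}
module Submission where

-- Write G n x for the right-hand side with aₙ = x.  The identity
-- W_{m+r} + q^r W_{m-r} = V_r W_m (both sides satisfy the Horadam recurrence in r)
-- together with Pascal's rule gives G (n+1) y - G (n+1) (y-1) = G n y, and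
-- G (n+1) (c-1) = 0 because binom(j, j+1) = 0.  As G 0 is the summand, each
-- summation telescopes, and under the paper's convention for empty and reversed
-- ranges it does so for every pair of bounds.

open import Defs
open import Data.Nat using (ℕ; zero; suc; _≥_; _∸_; _!)
import Data.Nat as ℕ
import Data.Nat.DivMod as ℕ
open import Data.Nat.Properties using (_!≢0)
import Data.Nat.Properties as ℕ
open import Data.Integer using (ℤ; +_; -[1+_])
import Data.Integer as ℤ
import Data.Integer.Properties as ℤ
open import Data.Integer.Divisibility.Signed using (_∣_; divides; ∣-refl; ∣m∣n⇒∣m+n; ∣m∣n⇒∣m-n; *-monoʳ-∣)
import Data.Integer.Tactic.RingSolver as ℤ-Solver
open import Data.Product using (_×_; _,_; proj₁)
open import Function using (_∘_)
open import Relation.Binary.PropositionalEquality using (_≡_; refl; cong; cong₂; sym; trans; subst; module ≡-Reasoning)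
open import Relation.Nullary using (¬_)

ℤ-ind : ∀ {ℓ} (P : ℤ → Set ℓ) → P (+ 0) →
        (∀ z → P z → P (ℤ.suc z)) → (∀ z → P z → P (ℤ.pred z)) → ∀ z → P z
ℤ-ind P P0 Psuc Ppred (+ zero)     = P0
ℤ-ind P P0 Psuc Ppred (+ suc n)    = Psuc (+ n) (ℤ-ind P P0 Psuc Ppred (+ n))
ℤ-ind P P0 Psuc Ppred -[1+ zero ]  = Ppred (+ 0) P0
ℤ-ind P P0 Psuc Ppred -[1+ suc n ] = Ppred -[1+ n ] (ℤ-ind P P0 Psuc Ppred -[1+ n ])

fallingℤ-pascal : ∀ N j →
  fallingℤ (ℤ.suc N) (suc j) ≡ fallingℤ N (suc j) ℤ.+ + suc j ℤ.* fallingℤ N j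
fallingℤ-pascal N zero    = base N
  where
  base : ∀ N → ℤ.1ℤ ℤ.* (ℤ.1ℤ ℤ.+ N ℤ.- + 0) ≡ ℤ.1ℤ ℤ.* (N ℤ.- + 0) ℤ.+ + 1 ℤ.* ℤ.1ℤ
  base = ℤ-Solver.solve-∀
fallingℤ-pascal N (suc j) =
  trans (cong (ℤ._* (ℤ.suc N ℤ.- + suc j)) (fallingℤ-pascal N j)) (step (fallingℤ N j) N (+ j))
  where
  step : ∀ F N J →
    (F ℤ.* (N ℤ.- J) ℤ.+ (+ 1 ℤ.+ J) ℤ.* F) ℤ.* ((ℤ.1ℤ ℤ.+ N) ℤ.- (+ 1 ℤ.+ J))
      ≡ F ℤ.* (N ℤ.- J) ℤ.* (N ℤ.- (+ 1 ℤ.+ J)) ℤ.+ (+ 1 ℤ.+ (+ 1 ℤ.+ J)) ℤ.* (F ℤ.* (N ℤ.- J))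
  step = ℤ-Solver.solve-∀

j!∣fallingℤ : ∀ j N → + (j !) ∣ fallingℤ N j
j!∣fallingℤ zero    N = ∣-refl
j!∣fallingℤ (suc j) = ℤ-ind (λ N → + (suc j !) ∣ fallingℤ N (suc j)) vanishes-at-0 upward downward
  where
  suc-j!∣ : ∀ N → + (suc j !) ∣ + suc j ℤ.* fallingℤ N j
  suc-j!∣ N rewrite ℤ.pos-* (suc j) (j !) = *-monoʳ-∣ (+ suc j) (j!∣fallingℤ j N)

  vanishes-at-0 : + (suc j !) ∣ fallingℤ (+ 0) (suc j)
  vanishes-at-0 = divides (+ 0) (falling-0 j)
    where
    falling-0 : ∀ j → fallingℤ (+ 0) (suc j) ≡ + 0
    falling-0 zero    = refl
    falling-0 (suc j) rewrite falling-0 j = refl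

  upward : ∀ N → + (suc j !) ∣ fallingℤ N (suc j) → + (suc j !) ∣ fallingℤ (ℤ.suc N) (suc j)
  upward N ∣F rewrite fallingℤ-pascal N j = ∣m∣n⇒∣m+n ∣F (suc-j!∣ N)

  downward : ∀ N → + (suc j !) ∣ fallingℤ N (suc j) → + (suc j !) ∣ fallingℤ (ℤ.pred N) (suc j)
  downward N ∣F = subst (+ (suc j !) ∣_) (sym pascal-backwards) (∣m∣n⇒∣m-n ∣F (suc-j!∣ (ℤ.pred N)))
    where
    pascal-backwards :
      fallingℤ (ℤ.pred N) (suc j) ≡ fallingℤ N (suc j) ℤ.- + suc j ℤ.* fallingℤ (ℤ.pred N) j
    pascal-backwards = begin
      fallingℤ (ℤ.pred N) (suc j)                              ≡⟨ cancel _ _ ⟨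
      fallingℤ (ℤ.pred N) (suc j) ℤ.+ X ℤ.- X                  ≡⟨ cong (ℤ._- X) (fallingℤ-pascal (ℤ.pred N) j) ⟨
      fallingℤ (ℤ.suc (ℤ.pred N)) (suc j) ℤ.- X                ≡⟨ cong (λ M → fallingℤ M (suc j) ℤ.- X) (ℤ.suc-pred N) ⟩
      fallingℤ N (suc j) ℤ.- X                                 ∎
      where
      open ≡-Reasoning
      X = + suc j ℤ.* fallingℤ (ℤ.pred N) j
      cancel : ∀ Y X → Y ℤ.+ X ℤ.- X ≡ Y
      cancel = ℤ-Solver.solve-∀

[k*d]/ℕd≡k : ∀ k d .{{_ : ℕ.NonZero d}} → (k ℤ.* + d) ℤ./ℕ d ≡ k
[k*d]/ℕd≡k (+ k) d@(suc _) = trans (cong (ℤ._/ℕ d) (sym (ℤ.pos-* k d))) (cong +_ (ℕ.m*n/n≡m k d))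
[k*d]/ℕd≡k -[1+ k ] (suc d) rewrite ℕ.m*n%n≡0 (suc k) (suc d) {{_}} | ℕ.m*n/n≡m (suc k) (suc d) {{_}} = refl

fallingℤ≡binomℤ*j! : ∀ N j → fallingℤ N j ≡ binomℤ N j ℤ.* + (j !)
fallingℤ≡binomℤ*j! N j with j!∣fallingℤ j N
... | divides k eq = trans eq (cong (ℤ._* + (j !)) (sym (trans (cong (λ F → ℤ._/ℕ_ F (j !) {{j !≢0}}) eq)
                                                                 ([k*d]/ℕd≡k k (j !) {{j !≢0}}))))

binomℤ-pascal : ∀ N j → binomℤ (ℤ.suc N) (suc j) ≡ binomℤ N (suc j) ℤ.+ binomℤ N j
binomℤ-pascal N j = ℤ.*-cancelʳ-≡ _ _ (+ (suc j !)) {{suc j !≢0}} (begin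
  binomℤ (ℤ.suc N) (suc j) ℤ.* + (suc j !)                       ≡⟨ fallingℤ≡binomℤ*j! (ℤ.suc N) (suc j) ⟨
  fallingℤ (ℤ.suc N) (suc j)                                     ≡⟨ fallingℤ-pascal N j ⟩
  fallingℤ N (suc j) ℤ.+ + suc j ℤ.* fallingℤ N j                 ≡⟨ cong₂ (λ F G → F ℤ.+ + suc j ℤ.* G)
                                                                       (fallingℤ≡binomℤ*j! N (suc j)) (fallingℤ≡binomℤ*j! N j) ⟩
  B₁ ℤ.* + (suc j !) ℤ.+ + suc j ℤ.* (B₀ ℤ.* + (j !))             ≡⟨ cong (λ F → B₁ ℤ.* F ℤ.+ + suc j ℤ.* (B₀ ℤ.* + (j !)))
                                                                       (ℤ.pos-* (suc j) (j !)) ⟩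
  B₁ ℤ.* (+ suc j ℤ.* + (j !)) ℤ.+ + suc j ℤ.* (B₀ ℤ.* + (j !))   ≡⟨ factor B₁ B₀ (+ suc j) (+ (j !)) ⟩
  (B₁ ℤ.+ B₀) ℤ.* (+ suc j ℤ.* + (j !))                          ≡⟨ cong ((B₁ ℤ.+ B₀) ℤ.*_) (ℤ.pos-* (suc j) (j !)) ⟨
  (B₁ ℤ.+ B₀) ℤ.* + (suc j !)                                    ∎)
  where
  open ≡-Reasoning
  B₁ = binomℤ N (suc j)
  B₀ = binomℤ N j
  factor : ∀ B₁ B₀ J F → B₁ ℤ.* (J ℤ.* F) ℤ.+ J ℤ.* (B₀ ℤ.* F) ≡ (B₁ ℤ.+ B₀) ℤ.* (J ℤ.* F)
  factor = ℤ-Solver.solve-∀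

binomℤ-vanishes : ∀ j → binomℤ (+ j) (suc j) ≡ + 0
binomℤ-vanishes j = ℤ.*-cancelʳ-≡ _ _ (+ (suc j !)) {{suc j !≢0}} (begin
  binomℤ (+ j) (suc j) ℤ.* + (suc j !)    ≡⟨ fallingℤ≡binomℤ*j! (+ j) (suc j) ⟨
  fallingℤ (+ j) j ℤ.* (+ j ℤ.- + j)      ≡⟨ cong (fallingℤ (+ j) j ℤ.*_) (ℤ.i≡j⇒i-j≡0 {+ j} refl) ⟩
  fallingℤ (+ j) j ℤ.* + 0                ≡⟨ ℤ.*-zeroʳ (fallingℤ (+ j) j) ⟩
  + 0                                     ∎)
  where open ≡-Reasoning

module _ {ℓ₁ ℓ₂} (F : Field ℓ₁ ℓ₂) where
  open Field F renaming (refl to ≈-refl; sym to ≈-sym; trans to ≈-trans)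
  open FieldDefs F
  open import Relation.Binary.Reasoning.Setoid setoid
  open import Algebra.Properties.Ring ring using (-‿distribˡ-*; -‿distribʳ-*; x[y-z]≈xy-xz; [y-z]x≈yx-zx; -1*x≈-x)
  open import Algebra.Properties.AbelianGroup +-abelianGroup using (⁻¹-∙-comm; ⁻¹-involutive; ε⁻¹≈ε; ⁻¹-anti-homo‿-)
  open import Algebra.Properties.CommutativeSemigroup +-commutativeSemigroup using () renaming (interchange to +-interchange)
  open import Algebra.Properties.CommutativeSemigroup *-commutativeSemigroup using (x∙yz≈y∙xz; x∙yz≈z∙xy) renaming (interchange to *-interchange)
  open import Algebra.Solver.Ring.AlmostCommutativeRing using (_-Raw-AlmostCommutative⟶_; fromCommutativeRing)
  open import Data.Maybe using (map)
  open import Relation.Nullary.Decidable using (dec⇒maybe)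

  fromℕ-+ : ∀ m n → fromℕ (m ℕ.+ n) ≈ fromℕ m + fromℕ n
  fromℕ-+ zero    n = ≈-sym (+-identityˡ _)
  fromℕ-+ (suc m) n = ≈-trans (+-congˡ (fromℕ-+ m n)) (≈-sym (+-assoc _ _ _))

  fromℕ-* : ∀ m n → fromℕ (m ℕ.* n) ≈ fromℕ m * fromℕ n
  fromℕ-* zero    n = ≈-sym (zeroˡ _)
  fromℕ-* (suc m) n = begin
    fromℕ (n ℕ.+ m ℕ.* n)                 ≈⟨ fromℕ-+ n (m ℕ.* n) ⟩
    fromℕ n + fromℕ (m ℕ.* n)             ≈⟨ +-cong (*-identityˡ _) (≈-sym (fromℕ-* m n)) ⟨
    1# * fromℕ n + fromℕ m * fromℕ n      ≈⟨ distribʳ _ _ _ ⟨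
    (1# + fromℕ m) * fromℕ n              ∎

  fromℤ-⊖ : ∀ m n → fromℤ (m ℤ.⊖ n) ≈ fromℕ m - fromℕ n
  fromℤ-⊖ m       zero    = ≈-sym (≈-trans (+-congˡ ε⁻¹≈ε) (+-identityʳ _))
  fromℤ-⊖ zero    (suc n) = ≈-sym (+-identityˡ _)
  fromℤ-⊖ (suc m) (suc n) = begin
    fromℤ (suc m ℤ.⊖ suc n)                   ≡⟨ cong fromℤ (ℤ.[1+m]⊖[1+n]≡m⊖n m n) ⟩
    fromℤ (m ℤ.⊖ n)                           ≈⟨ fromℤ-⊖ m n ⟩
    fromℕ m - fromℕ n                         ≈⟨ +-identityˡ _ ⟨
    0# + (fromℕ m - fromℕ n)                  ≈⟨ +-congʳ (-‿inverseʳ 1#) ⟨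
    (1# - 1#) + (fromℕ m - fromℕ n)           ≈⟨ +-interchange 1# (fromℕ m) (- 1#) (- fromℕ n) ⟨
    (1# + fromℕ m) + (- 1# - fromℕ n)         ≈⟨ +-congˡ (⁻¹-∙-comm 1# (fromℕ n)) ⟩
    fromℕ (suc m) - fromℕ (suc n)             ∎

  fromℤ-neg : ∀ z → fromℤ (ℤ.- z) ≈ - fromℤ z
  fromℤ-neg (+ zero)  = ≈-sym ε⁻¹≈ε
  fromℤ-neg (+ suc n) = ≈-refl
  fromℤ-neg -[1+ n ]  = ≈-sym (⁻¹-involutive _)

  fromℤ-+ : ∀ x y → fromℤ (x ℤ.+ y) ≈ fromℤ x + fromℤ y
  fromℤ-+ (+ m)    (+ n)    = fromℕ-+ m n
  fromℤ-+ (+ m)    -[1+ n ] = fromℤ-⊖ m (suc n)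
  fromℤ-+ -[1+ m ] (+ n)    = ≈-trans (fromℤ-⊖ n (suc m)) (+-comm _ _)
  fromℤ-+ -[1+ m ] -[1+ n ] = begin
    - fromℕ (suc (suc (m ℕ.+ n)))             ≡⟨ cong (λ k → - fromℕ k) (ℕ.+-suc (suc m) n) ⟨
    - fromℕ (suc m ℕ.+ suc n)                 ≈⟨ -‿cong (fromℕ-+ (suc m) (suc n)) ⟩
    - (fromℕ (suc m) + fromℕ (suc n))         ≈⟨ ⁻¹-∙-comm _ _ ⟨
    - fromℕ (suc m) - fromℕ (suc n)           ∎

  fromℤ-+* : ∀ m y → fromℤ (+ m ℤ.* y) ≈ fromℕ m * fromℤ y
  fromℤ-+* m (+ n) = begin
    fromℤ (+ m ℤ.* + n)             ≡⟨ cong fromℤ (ℤ.pos-* m n) ⟨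
    fromℕ (m ℕ.* n)                 ≈⟨ fromℕ-* m n ⟩
    fromℕ m * fromℕ n               ∎
  fromℤ-+* m -[1+ n ] = begin
    fromℤ (+ m ℤ.* ℤ.- + suc n)     ≡⟨ cong fromℤ (ℤ.neg-distribʳ-* (+ m) (+ suc n)) ⟨
    fromℤ (ℤ.- (+ m ℤ.* + suc n))   ≈⟨ fromℤ-neg (+ m ℤ.* + suc n) ⟩
    - fromℤ (+ m ℤ.* + suc n)       ≈⟨ -‿cong (fromℤ-+* m (+ suc n)) ⟩
    - (fromℕ m * fromℕ (suc n))     ≈⟨ -‿distribʳ-* _ _ ⟩
    fromℕ m * - fromℕ (suc n)       ∎

  fromℤ-* : ∀ x y → fromℤ (x ℤ.* y) ≈ fromℤ x * fromℤ y
  fromℤ-* (+ m)    y = fromℤ-+* m y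
  fromℤ-* -[1+ m ] y = begin
    fromℤ (ℤ.- + suc m ℤ.* y)       ≡⟨ cong fromℤ (ℤ.neg-distribˡ-* (+ suc m) y) ⟨
    fromℤ (ℤ.- (+ suc m ℤ.* y))     ≈⟨ fromℤ-neg (+ suc m ℤ.* y) ⟩
    - fromℤ (+ suc m ℤ.* y)         ≈⟨ -‿cong (fromℤ-+* (suc m) y) ⟩
    - (fromℕ (suc m) * fromℤ y)     ≈⟨ -‿distribˡ-* _ _ ⟩
    - fromℕ (suc m) * fromℤ y       ∎

  fromℤ-homomorphism : ℤ.+-*-rawRing -Raw-AlmostCommutative⟶ fromCommutativeRing commutativeRing
  fromℤ-homomorphism = record
    { ⟦_⟧ = fromℤ ; +-homo = fromℤ-+ ; *-homo = fromℤ-* ; -‿homo = fromℤ-neg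
    ; 0-homo = ≈-refl ; 1-homo = +-identityʳ 1# }

  open import Algebra.Solver.Ring ℤ.+-*-rawRing (fromCommutativeRing commutativeRing) fromℤ-homomorphism
    (λ i j → map (λ i≡j → reflexive (cong fromℤ i≡j)) (dec⇒maybe (i ℤ.≟ j)))

  x⁻¹*[x*y]≈y : ∀ {x} y → x ≉ 0# → x ⁻¹ * (x * y) ≈ y
  x⁻¹*[x*y]≈y {x} y x≉0 = begin
    x ⁻¹ * (x * y)      ≈⟨ *-assoc _ _ _ ⟨
    x ⁻¹ * x * y        ≈⟨ *-congʳ (≈-trans (*-comm _ _) (inverseʳ x x≉0)) ⟩
    1# * y              ≈⟨ *-identityˡ y ⟩
    y                   ∎

  *-nonzero : ∀ {x y} → x ≉ 0# → y ≉ 0# → x * y ≉ 0#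
  *-nonzero {x} {y} x≉0 y≉0 xy≈0 =
    y≉0 (≈-trans (≈-sym (x⁻¹*[x*y]≈y y x≉0)) (≈-trans (*-congˡ xy≈0) (zeroʳ _)))

  ⁻¹-unique : ∀ x y → x * y ≈ 1# → x ⁻¹ ≈ y
  ⁻¹-unique x y xy≈1 = ≈-trans (≈-sym (≈-trans (*-congˡ xy≈1) (*-identityʳ _))) (x⁻¹*[x*y]≈y y x≉0)
    where
    x≉0 : x ≉ 0#
    x≉0 x≈0 = 1≉0 (≈-trans (≈-sym xy≈1) (≈-trans (*-congʳ x≈0) (zeroˡ y)))

  ⁻¹-distrib-* : ∀ {x y} → x ≉ 0# → y ≉ 0# → (x * y) ⁻¹ ≈ x ⁻¹ * y ⁻¹
  ⁻¹-distrib-* {x} {y} x≉0 y≉0 = ⁻¹-unique (x * y) (x ⁻¹ * y ⁻¹) (begin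
    x * y * (x ⁻¹ * y ⁻¹)       ≈⟨ *-interchange x y (x ⁻¹) (y ⁻¹) ⟩
    x * x ⁻¹ * (y * y ⁻¹)       ≈⟨ *-cong (inverseʳ x x≉0) (inverseʳ y y≉0) ⟩
    1# * 1#                     ≈⟨ *-identityˡ 1# ⟩
    1#                          ∎)

  x*[x*y]⁻¹≈y⁻¹ : ∀ {x y} → x ≉ 0# → y ≉ 0# → x * (x * y) ⁻¹ ≈ y ⁻¹
  x*[x*y]⁻¹≈y⁻¹ {x} {y} x≉0 y≉0 = begin
    x * (x * y) ⁻¹              ≈⟨ *-congˡ (⁻¹-distrib-* x≉0 y≉0) ⟩
    x * (x ⁻¹ * y ⁻¹)           ≈⟨ *-assoc _ _ _ ⟨
    x * x ⁻¹ * y ⁻¹             ≈⟨ *-congʳ (inverseʳ x x≉0) ⟩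
    1# * y ⁻¹                   ≈⟨ *-identityˡ _ ⟩
    y ⁻¹                        ∎

  module _ {x} (x≉0 : x ≉ 0#) where

    ^ᶻ-suc : ∀ z → x ^ᶻ ℤ.suc z ≈ x * x ^ᶻ z
    ^ᶻ-suc (+ n)           = ≈-refl
    ^ᶻ-suc -[1+ zero ]     = ≈-sym (≈-trans (*-congˡ (*-identityʳ _)) (inverseʳ x x≉0))
    ^ᶻ-suc -[1+ suc n ]    = ≈-sym (≈-trans (x∙yz≈y∙xz x (x ⁻¹) _) (x⁻¹*[x*y]≈y _ x≉0))

    ^ᶻ-pred : ∀ z → x ^ᶻ z ≈ x * x ^ᶻ ℤ.pred z
    ^ᶻ-pred z = ≈-trans (reflexive (cong (x ^ᶻ_) (sym (ℤ.suc-pred z)))) (^ᶻ-suc (ℤ.pred z))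

    ^ᶻ-nonzero : ∀ z → x ^ᶻ z ≉ 0#
    ^ᶻ-nonzero = ℤ-ind (λ z → x ^ᶻ z ≉ 0#) 1≉0
      (λ z xᶻ≉0 xᶻ⁺¹≈0 → *-nonzero x≉0 xᶻ≉0 (≈-trans (≈-sym (^ᶻ-suc z)) xᶻ⁺¹≈0))
      (λ z xᶻ≉0 xᶻ⁻¹≈0 → xᶻ≉0 (≈-trans (^ᶻ-pred z) (≈-trans (*-congˡ xᶻ⁻¹≈0) (zeroʳ x))))

    ^ᶻ-+ : ∀ i j → x ^ᶻ (i ℤ.+ j) ≈ x ^ᶻ i * x ^ᶻ j
    ^ᶻ-+ i = ℤ-ind (λ j → x ^ᶻ (i ℤ.+ j) ≈ x ^ᶻ i * x ^ᶻ j)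
      (≈-trans (reflexive (cong (x ^ᶻ_) (ℤ.+-identityʳ i))) (≈-sym (*-identityʳ _)))
      (λ j IH → begin
        x ^ᶻ (i ℤ.+ ℤ.suc j)                  ≡⟨ cong (x ^ᶻ_) (+-suc i j) ⟩
        x ^ᶻ ℤ.suc (i ℤ.+ j)                  ≈⟨ ^ᶻ-suc (i ℤ.+ j) ⟩
        x * x ^ᶻ (i ℤ.+ j)                    ≈⟨ *-congˡ IH ⟩
        x * (x ^ᶻ i * x ^ᶻ j)                 ≈⟨ x∙yz≈y∙xz x _ _ ⟩
        x ^ᶻ i * (x * x ^ᶻ j)                 ≈⟨ *-congˡ (^ᶻ-suc j) ⟨
        x ^ᶻ i * x ^ᶻ ℤ.suc j                 ∎)
      (λ j IH → begin
        x ^ᶻ (i ℤ.+ ℤ.pred j)                 ≈⟨ x⁻¹*[x*y]≈y _ x≉0 ⟨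
        x ⁻¹ * (x * x ^ᶻ (i ℤ.+ ℤ.pred j))    ≈⟨ *-congˡ (^ᶻ-suc (i ℤ.+ ℤ.pred j)) ⟨
        x ⁻¹ * x ^ᶻ ℤ.suc (i ℤ.+ ℤ.pred j)    ≡⟨ cong (λ k → x ⁻¹ * x ^ᶻ k) (suc-+-pred i j) ⟩
        x ⁻¹ * x ^ᶻ (i ℤ.+ j)                 ≈⟨ *-congˡ IH ⟩
        x ⁻¹ * (x ^ᶻ i * x ^ᶻ j)              ≈⟨ *-congˡ (*-congˡ (^ᶻ-pred j)) ⟩
        x ⁻¹ * (x ^ᶻ i * (x * x ^ᶻ ℤ.pred j)) ≈⟨ *-congˡ (x∙yz≈y∙xz _ _ _) ⟩
        x ⁻¹ * (x * (x ^ᶻ i * x ^ᶻ ℤ.pred j)) ≈⟨ x⁻¹*[x*y]≈y _ x≉0 ⟩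
        x ^ᶻ i * x ^ᶻ ℤ.pred j                ∎)
      where
      +-suc : ∀ m n → m ℤ.+ (ℤ.1ℤ ℤ.+ n) ≡ ℤ.1ℤ ℤ.+ (m ℤ.+ n)
      +-suc = ℤ-Solver.solve-∀
      suc-+-pred : ∀ m n → ℤ.1ℤ ℤ.+ (m ℤ.+ (ℤ.-1ℤ ℤ.+ n)) ≡ m ℤ.+ n
      suc-+-pred = ℤ-Solver.solve-∀

  sumℕ-cong : ∀ n {f g : ℕ → Carrier} → (∀ i → f i ≈ g i) → sumℕ n f ≈ sumℕ n g
  sumℕ-cong zero    f≈g = ≈-refl
  sumℕ-cong (suc n) f≈g = +-cong (sumℕ-cong n f≈g) (f≈g n)

  sumℕ-zero : ∀ n {f : ℕ → Carrier} → (∀ i → f i ≈ 0#) → sumℕ n f ≈ 0#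
  sumℕ-zero zero    f≈0 = ≈-refl
  sumℕ-zero (suc n) f≈0 = ≈-trans (+-cong (sumℕ-zero n f≈0) (f≈0 n)) (+-identityʳ 0#)

  sumℕ-sub : ∀ n (f g : ℕ → Carrier) → sumℕ n f - sumℕ n g ≈ sumℕ n (λ i → f i - g i)
  sumℕ-sub zero    f g = ≈-trans (+-congˡ ε⁻¹≈ε) (+-identityʳ 0#)
  sumℕ-sub (suc n) f g = begin
    (sumℕ n f + f n) - (sumℕ n g + g n)            ≈⟨ +-congˡ (⁻¹-∙-comm _ _) ⟨
    (sumℕ n f + f n) + (- sumℕ n g - g n)          ≈⟨ +-interchange _ _ _ _ ⟩
    (sumℕ n f - sumℕ n g) + (f n - g n)            ≈⟨ +-congʳ (sumℕ-sub n f g) ⟩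
    sumℕ n (λ i → f i - g i) + (f n - g n)         ∎

  sumℕ-suc-first : ∀ n (f : ℕ → Carrier) → sumℕ (suc n) f ≈ f 0 + sumℕ n (λ i → f (suc i))
  sumℕ-suc-first zero    f = ≈-trans (+-identityˡ _) (≈-sym (+-identityʳ _))
  sumℕ-suc-first (suc n) f = ≈-trans (+-congʳ (sumℕ-suc-first n f)) (+-assoc _ _ _)

  sumℤ-cong : ∀ m M {h h′ : ℤ → Carrier} → (∀ y → h y ≈ h′ y) → sumℤ m M h ≈ sumℤ m M h′
  sumℤ-cong m M h≈h′ with M ℤ.- m ℤ.+ ℤ.1ℤ
  ... | + n      = sumℕ-cong n (λ i → h≈h′ _)
  ... | -[1+ n ] = -‿cong (sumℕ-cong (suc n) (λ i → h≈h′ _))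

  module _ (G : ℤ → Carrier) where

    sumℕ-telescope : ∀ m n →
      sumℕ n (λ i → G (m ℤ.+ + i) - G (ℤ.pred (m ℤ.+ + i))) ≈ G (ℤ.pred (m ℤ.+ + n)) - G (ℤ.pred m)
    sumℕ-telescope m zero    =
      ≈-sym (≈-trans (+-congʳ (reflexive (cong (G ∘ ℤ.pred) (ℤ.+-identityʳ m)))) (-‿inverseʳ _))
    sumℕ-telescope m (suc n) = begin
      sumℕ n (λ i → G (m ℤ.+ + i) - G (ℤ.pred (m ℤ.+ + i))) + (G (m ℤ.+ + n) - G (ℤ.pred (m ℤ.+ + n)))
        ≈⟨ +-congʳ (sumℕ-telescope m n) ⟩
      (G (ℤ.pred (m ℤ.+ + n)) - G (ℤ.pred m)) + (G (m ℤ.+ + n) - G (ℤ.pred (m ℤ.+ + n)))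
        ≈⟨ telescope _ _ _ ⟩
      G (m ℤ.+ + n) - G (ℤ.pred m)
        ≡⟨ cong (λ k → G k - G (ℤ.pred m)) (pred-+-suc m (+ n)) ⟨
      G (ℤ.pred (m ℤ.+ + suc n)) - G (ℤ.pred m) ∎
      where
      telescope : ∀ a b c → (a - b) + (c - a) ≈ c - b
      telescope = solve 3 (λ a b c → (a :- b) :+ (c :- a) := c :- b) ≈-refl
      pred-+-suc : ∀ m n → ℤ.-1ℤ ℤ.+ (m ℤ.+ (ℤ.1ℤ ℤ.+ n)) ≡ m ℤ.+ n
      pred-+-suc = ℤ-Solver.solve-∀

    sumℤ-telescope : ∀ m M → sumℤ m M (λ y → G y - G (ℤ.pred y)) ≈ G M - G (ℤ.pred m)
    sumℤ-telescope m M with M ℤ.- m ℤ.+ ℤ.1ℤ in eq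
    ... | + n      = ≈-trans (sumℕ-telescope m n) (+-congʳ (reflexive (cong G upper-end)))
      where
      cancel : ∀ M m → ℤ.-1ℤ ℤ.+ (m ℤ.+ (M ℤ.- m ℤ.+ ℤ.1ℤ)) ≡ M
      cancel = ℤ-Solver.solve-∀
      upper-end : ℤ.-1ℤ ℤ.+ (m ℤ.+ + n) ≡ M
      upper-end = trans (cong (λ d → ℤ.-1ℤ ℤ.+ (m ℤ.+ d)) (sym eq)) (cancel M m)
    ... | -[1+ n ] = begin
      - sumℕ (suc n) (λ i → G (M′ ℤ.+ + i) - G (ℤ.pred (M′ ℤ.+ + i)))
        ≈⟨ -‿cong (sumℕ-telescope M′ (suc n)) ⟩
      - (G (ℤ.pred (M′ ℤ.+ + suc n)) - G (ℤ.pred M′))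
        ≈⟨ ⁻¹-anti-homo‿- _ _ ⟩
      G (ℤ.pred M′) - G (ℤ.pred (M′ ℤ.+ + suc n))
        ≡⟨ cong₂ (λ k l → G k - G l) (pred-suc M) lower-end ⟩
      G M - G (ℤ.pred m) ∎
      where
      M′ = M ℤ.+ ℤ.1ℤ
      pred-suc : ∀ M → ℤ.-1ℤ ℤ.+ (M ℤ.+ ℤ.1ℤ) ≡ M
      pred-suc = ℤ-Solver.solve-∀
      regroup : ∀ M m k → ℤ.-1ℤ ℤ.+ (M ℤ.+ ℤ.1ℤ ℤ.+ k) ≡ ℤ.-1ℤ ℤ.+ ((M ℤ.- m ℤ.+ ℤ.1ℤ) ℤ.+ k ℤ.+ m)
      regroup = ℤ-Solver.solve-∀
      cancel : ∀ k m → ℤ.-1ℤ ℤ.+ (ℤ.- k ℤ.+ k ℤ.+ m) ≡ ℤ.-1ℤ ℤ.+ m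
      cancel = ℤ-Solver.solve-∀
      lower-end : ℤ.-1ℤ ℤ.+ (M′ ℤ.+ + suc n) ≡ ℤ.-1ℤ ℤ.+ m
      lower-end = trans (regroup M m (+ suc n))
                        (trans (cong (λ d → ℤ.-1ℤ ℤ.+ (d ℤ.+ + suc n ℤ.+ m)) eq) (cancel (+ suc n) m))

  x-[x-y]≈y : ∀ x y → x - (x - y) ≈ y
  x-[x-y]≈y = solve 2 (λ x y → x :- (x :- y) := y) ≈-refl

  module _ (p q : Carrier) where

    Recurrent : (ℤ → Carrier) → Set ℓ₂
    Recurrent f = ∀ z → f (ℤ.suc (ℤ.suc z)) ≈ p * f (ℤ.suc z) - q * f z

    module _ (q≉0 : q ≉ 0#) where

      backward-step : ∀ x y → y ≈ p * x - q * ((p * x - y) / q)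
      backward-step x y = ≈-sym (begin
        p * x - q * ((p * x - y) * q ⁻¹)     ≈⟨ +-congˡ (-‿cong (x∙yz≈z∙xy q _ _)) ⟩
        p * x - q ⁻¹ * (q * (p * x - y))     ≈⟨ +-congˡ (-‿cong (x⁻¹*[x*y]≈y _ q≉0)) ⟩
        p * x - (p * x - y)                  ≈⟨ x-[x-y]≈y _ _ ⟩
        y                                    ∎)

      -- The negative cases are split only so that the backward recursion of W unfolds.
      W-recurrent : ∀ a b → Recurrent (W a b p q)
      W-recurrent a b (+ n)              = ≈-refl
      W-recurrent a b -[1+ 0 ]           = backward-step _ _
      W-recurrent a b -[1+ 1 ]           = backward-step _ _
      W-recurrent a b -[1+ suc (suc n) ] = backward-step _ _

      recurrent-backward : ∀ {h} → Recurrent h → ∀ z → q * h (ℤ.pred z) ≈ p * h z - h (ℤ.suc z)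
      recurrent-backward {h} rec z = begin
        q * h (ℤ.pred z)                                         ≈⟨ x-[x-y]≈y _ _ ⟨
        p * h z - (p * h z - q * h (ℤ.pred z))                   ≈⟨ +-congˡ (-‿cong (begin
          p * h z - q * h (ℤ.pred z)                               ≡⟨ cong (λ k → p * h k - q * h (ℤ.pred z)) (ℤ.suc-pred z) ⟨
          p * h (ℤ.suc (ℤ.pred z)) - q * h (ℤ.pred z)              ≈⟨ rec (ℤ.pred z) ⟨
          h (ℤ.suc (ℤ.suc (ℤ.pred z)))                             ≡⟨ cong (h ∘ ℤ.suc) (ℤ.suc-pred z) ⟩
          h (ℤ.suc z)                                              ∎)) ⟩
        p * h z - h (ℤ.suc z)                                    ∎

      recurrent-unique : ∀ {f g} → Recurrent f → Recurrent g →
        f (+ 0) ≈ g (+ 0) → f (+ 1) ≈ g (+ 1) → ∀ z → f z ≈ g z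
      recurrent-unique {f} {g} rec-f rec-g f₀≈g₀ f₁≈g₁ z = proj₁ (ℤ-ind Agree (f₀≈g₀ , f₁≈g₁) upward downward z)
        where
        Agree : ℤ → Set ℓ₂
        Agree z = f z ≈ g z × f (ℤ.suc z) ≈ g (ℤ.suc z)

        upward : ∀ z → Agree z → Agree (ℤ.suc z)
        upward z (f≈g , f′≈g′) = f′≈g′ , (begin
          f (ℤ.suc (ℤ.suc z))                ≈⟨ rec-f z ⟩
          p * f (ℤ.suc z) - q * f z          ≈⟨ +-cong (*-congˡ f′≈g′) (-‿cong (*-congˡ f≈g)) ⟩
          p * g (ℤ.suc z) - q * g z          ≈⟨ rec-g z ⟨
          g (ℤ.suc (ℤ.suc z))                ∎)

        downward : ∀ z → Agree z → Agree (ℤ.pred z)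
        downward z (f≈g , f′≈g′) = (begin
          f (ℤ.pred z)                       ≈⟨ x⁻¹*[x*y]≈y _ q≉0 ⟨
          q ⁻¹ * (q * f (ℤ.pred z))          ≈⟨ *-congˡ (recurrent-backward rec-f z) ⟩
          q ⁻¹ * (p * f z - f (ℤ.suc z))     ≈⟨ *-congˡ (+-cong (*-congˡ f≈g) (-‿cong f′≈g′)) ⟩
          q ⁻¹ * (p * g z - g (ℤ.suc z))     ≈⟨ *-congˡ (recurrent-backward rec-g z) ⟨
          q ⁻¹ * (q * g (ℤ.pred z))          ≈⟨ x⁻¹*[x*y]≈y _ q≉0 ⟩
          g (ℤ.pred z)                       ∎) , (begin
          f (ℤ.suc (ℤ.pred z))               ≡⟨ cong f (ℤ.suc-pred z) ⟩
          f z                                ≈⟨ f≈g ⟩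
          g z                                ≡⟨ cong g (ℤ.suc-pred z) ⟨
          g (ℤ.suc (ℤ.pred z))               ∎)

      W[m+r]+qʳW[m-r]≈VᵣWₘ : ∀ a b m r →
        W a b p q (m ℤ.+ r) + q ^ᶻ r * W a b p q (m ℤ.- r) ≈ V p q r * W a b p q m
      W[m+r]+qʳW[m-r]≈VᵣWₘ a b m = recurrent-unique rec-lhs rec-rhs at-0 at-1
        where
        w = W a b p q

        rec-rhs : Recurrent (λ r → V p q r * w m)
        rec-rhs z = ≈-trans (*-congʳ (W-recurrent (1# + 1#) p z))
                            (≈-trans ([y-z]x≈yx-zx _ _ _) (+-cong (*-assoc _ _ _) (-‿cong (*-assoc _ _ _))))

        rec-lhs : Recurrent (λ r → w (m ℤ.+ r) + q ^ᶻ r * w (m ℤ.- r))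
        rec-lhs z = begin
          w (m ℤ.+ ℤ.suc (ℤ.suc z)) + q ^ᶻ ℤ.suc (ℤ.suc z) * w k
            ≈⟨ +-cong (≈-trans (reflexive (cong w (+-suc-suc m z))) (W-recurrent a b (m ℤ.+ z)))
                      (*-congʳ (≈-trans (^ᶻ-suc q≉0 (ℤ.suc z)) (*-congˡ (^ᶻ-suc q≉0 z)))) ⟩
          (p * w (ℤ.suc (m ℤ.+ z)) - q * w (m ℤ.+ z)) + q * (q * q ^ᶻ z) * w k
            ≈⟨ regroup _ _ _ _ _ _ _ ⟩
          p * (w (ℤ.suc (m ℤ.+ z)) + q * q ^ᶻ z * w (ℤ.suc k))
            - q * (w (m ℤ.+ z) + q ^ᶻ z * (p * w (ℤ.suc k) - q * w k))
            ≈⟨ +-cong (*-congˡ (+-cong (reflexive (cong w (sym (+-suc m z))))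
                                       (*-cong (≈-sym (^ᶻ-suc q≉0 z)) (reflexive (cong w (suc-k m z))))))
                      (-‿cong (*-congˡ (+-congˡ (*-congˡ
                         (≈-trans (≈-sym (W-recurrent a b k)) (reflexive (cong w (suc-suc-k m z)))))))) ⟩
          p * (w (m ℤ.+ ℤ.suc z) + q ^ᶻ ℤ.suc z * w (m ℤ.- ℤ.suc z))
            - q * (w (m ℤ.+ z) + q ^ᶻ z * w (m ℤ.- z)) ∎
          where
          k = m ℤ.- ℤ.suc (ℤ.suc z)
          +-suc : ∀ m z → m ℤ.+ (ℤ.1ℤ ℤ.+ z) ≡ ℤ.1ℤ ℤ.+ (m ℤ.+ z)
          +-suc = ℤ-Solver.solve-∀
          +-suc-suc : ∀ m z → m ℤ.+ (ℤ.1ℤ ℤ.+ (ℤ.1ℤ ℤ.+ z)) ≡ ℤ.1ℤ ℤ.+ (ℤ.1ℤ ℤ.+ (m ℤ.+ z))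
          +-suc-suc = ℤ-Solver.solve-∀
          suc-k : ∀ m z → ℤ.1ℤ ℤ.+ (m ℤ.- (ℤ.1ℤ ℤ.+ (ℤ.1ℤ ℤ.+ z))) ≡ m ℤ.- (ℤ.1ℤ ℤ.+ z)
          suc-k = ℤ-Solver.solve-∀
          suc-suc-k : ∀ m z → ℤ.1ℤ ℤ.+ (ℤ.1ℤ ℤ.+ (m ℤ.- (ℤ.1ℤ ℤ.+ (ℤ.1ℤ ℤ.+ z)))) ≡ m ℤ.- z
          suc-suc-k = ℤ-Solver.solve-∀
          regroup : ∀ p q u₁ u₀ Q v₁ v₀ → (p * u₁ - q * u₀) + q * (q * Q) * v₀
            ≈ p * (u₁ + q * Q * v₁) - q * (u₀ + Q * (p * v₁ - q * v₀))
          regroup = solve 7 (λ p q u₁ u₀ Q v₁ v₀ → (p :* u₁ :- q :* u₀) :+ q :* (q :* Q) :* v₀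
            := p :* (u₁ :+ q :* Q :* v₁) :- q :* (u₀ :+ Q :* (p :* v₁ :- q :* v₀))) ≈-refl

        at-0 : w (m ℤ.+ + 0) + 1# * w (m ℤ.- + 0) ≈ (1# + 1#) * w m
        at-0 = begin
          w (m ℤ.+ + 0) + 1# * w (m ℤ.- + 0)   ≈⟨ +-cong (reflexive (cong w (ℤ.+-identityʳ m)))
                                                        (≈-trans (*-identityˡ _) (reflexive (cong w (ℤ.+-identityʳ m)))) ⟩
          w m + w m                            ≈⟨ +-cong (*-identityˡ _) (*-identityˡ _) ⟨
          1# * w m + 1# * w m                  ≈⟨ distribʳ _ _ _ ⟨
          (1# + 1#) * w m                      ∎

        at-1 : w (m ℤ.+ + 1) + q * 1# * w (m ℤ.- + 1) ≈ p * w m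
        at-1 = begin
          w (m ℤ.+ + 1) + q * 1# * w (m ℤ.- + 1)
            ≈⟨ +-cong (≈-trans (reflexive (cong w (sym (suc-suc-[m-1] m)))) (W-recurrent a b (m ℤ.- + 1)))
                      (*-congʳ (*-identityʳ q)) ⟩
          (p * w (ℤ.suc (m ℤ.- + 1)) - q * w (m ℤ.- + 1)) + q * w (m ℤ.- + 1)
            ≈⟨ x-y+y≈x _ _ ⟩
          p * w (ℤ.suc (m ℤ.- + 1))
            ≡⟨ cong (λ k → p * w k) (suc-[m-1] m) ⟩
          p * w m ∎
          where
          suc-suc-[m-1] : ∀ m → ℤ.1ℤ ℤ.+ (ℤ.1ℤ ℤ.+ (m ℤ.- ℤ.1ℤ)) ≡ m ℤ.+ ℤ.1ℤ
          suc-suc-[m-1] = ℤ-Solver.solve-∀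
          suc-[m-1] : ∀ m → ℤ.1ℤ ℤ.+ (m ℤ.- ℤ.1ℤ) ≡ m
          suc-[m-1] = ℤ-Solver.solve-∀
          x-y+y≈x : ∀ x y → x - y + y ≈ x
          x-y+y≈x = solve 2 (λ x y → x :- y :+ y := x) ≈-refl

  module ClosedForm (a b p q : Carrier) (q≉0 : q ≉ 0#) (r s c : ℤ) (Vᵣ≉0 : V p q r ≉ 0#) where

    w : ℤ → Carrier
    w = W a b p q

    Vᵣ : Carrier
    Vᵣ = V p q r

    summand : ℤ → Carrier
    summand a₀ = w (r ℤ.* a₀ ℤ.+ s) / (Vᵣ ^ᶻ a₀)

    leading : ℕ → ℤ → Carrier
    leading n x = (- 1#) ^ⁿ n * w (r ℤ.* (x ℤ.+ + 2 ℤ.* + n) ℤ.+ s) / (q ^ᶻ (r ℤ.* + n) * (Vᵣ ^ᶻ x))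

    coefficient : ℕ → ℕ → Carrier
    coefficient n j = (- 1#) ^ⁿ (n ∸ j) * w (r ℤ.* (+ 2 ℤ.* + n ℤ.- + 2 ℤ.* + j ℤ.+ c ℤ.- ℤ.1ℤ) ℤ.+ s)
                      / (q ^ᶻ (r ℤ.* (+ n ℤ.- + j)))

    correction : ℕ → ℤ → Carrier
    correction n x = sumℕ n (λ j → coefficient n j * fromℤ (binomℤ (x ℤ.+ + j ℤ.- c) j))

    closedForm : ℕ → ℤ → Carrier
    closedForm n x = leading n x - 1# / (Vᵣ ^ᶻ (c ℤ.- ℤ.1ℤ)) * correction n x

    denominator-nonzero : ∀ k x → q ^ᶻ k * Vᵣ ^ᶻ x ≉ 0#
    denominator-nonzero k x = *-nonzero (^ᶻ-nonzero q≉0 k) (^ᶻ-nonzero Vᵣ≉0 x)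

    leading-difference : ∀ n y → leading (suc n) y - leading (suc n) (ℤ.pred y) ≈ leading n y
    leading-difference n y = begin
      leading (suc n) y - leading (suc n) (ℤ.pred y)
        ≈⟨ +-cong (*-congʳ (*-cong (-1*x≈-x e) (≈-trans (reflexive (cong w (index₊ r y (+ n) s))) descending)))
                  (-‿cong (*-cong (*-cong (-1*x≈-x e) (reflexive (cong w (index₀ r y (+ n) s)))) Vᵣ-scaling)) ⟩
      (- e * (Vᵣ * w m - qʳ * w (m ℤ.- r))) * D - (- e * w m) * (Vᵣ * D)
        ≈⟨ collect _ _ _ _ _ _ ⟩
      e * w (m ℤ.- r) * (qʳ * D)
        ≈⟨ *-cong (*-congˡ (reflexive (cong w (sym (index₋ r y (+ n) s))))) (≈-sym qʳ-scaling) ⟩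
      leading n y ∎
      where
      index₊ : ∀ r y n s → r ℤ.* (y ℤ.+ + 2 ℤ.* (+ 1 ℤ.+ n)) ℤ.+ s ≡ (r ℤ.* (y ℤ.+ + 2 ℤ.* n) ℤ.+ s ℤ.+ r) ℤ.+ r
      index₊ = ℤ-Solver.solve-∀
      index₀ : ∀ r y n s → r ℤ.* ((ℤ.-1ℤ ℤ.+ y) ℤ.+ + 2 ℤ.* (+ 1 ℤ.+ n)) ℤ.+ s ≡ r ℤ.* (y ℤ.+ + 2 ℤ.* n) ℤ.+ s ℤ.+ r
      index₀ = ℤ-Solver.solve-∀
      index₋ : ∀ r y n s → r ℤ.* (y ℤ.+ + 2 ℤ.* n) ℤ.+ s ≡ (r ℤ.* (y ℤ.+ + 2 ℤ.* n) ℤ.+ s ℤ.+ r) ℤ.- r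
      index₋ = ℤ-Solver.solve-∀
      *-suc : ∀ r n → r ℤ.* (+ 1 ℤ.+ n) ≡ r ℤ.+ r ℤ.* n
      *-suc = ℤ-Solver.solve-∀

      e  = (- 1#) ^ⁿ n
      m  = r ℤ.* (y ℤ.+ + 2 ℤ.* + n) ℤ.+ s ℤ.+ r
      qʳ = q ^ᶻ r
      D  = (q ^ᶻ (r ℤ.* + suc n) * Vᵣ ^ᶻ y) ⁻¹

      descending : w (m ℤ.+ r) ≈ Vᵣ * w m - qʳ * w (m ℤ.- r)
      descending = ≈-trans (≈-sym (x+y-y≈x _ _)) (+-congʳ (W[m+r]+qʳW[m-r]≈VᵣWₘ p q q≉0 a b m r))
        where
        x+y-y≈x : ∀ x y → x + y - y ≈ x
        x+y-y≈x = solve 2 (λ x y → x :+ y :- y := x) ≈-refl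

      qʳ-scaling : (q ^ᶻ (r ℤ.* + n) * Vᵣ ^ᶻ y) ⁻¹ ≈ qʳ * D
      qʳ-scaling = ≈-trans (≈-sym (x*[x*y]⁻¹≈y⁻¹ (^ᶻ-nonzero q≉0 r) (denominator-nonzero (r ℤ.* + n) y)))
                           (*-congˡ (⁻¹-cong (begin
        qʳ * (q ^ᶻ (r ℤ.* + n) * Vᵣ ^ᶻ y)     ≈⟨ *-assoc _ _ _ ⟨
        qʳ * q ^ᶻ (r ℤ.* + n) * Vᵣ ^ᶻ y       ≈⟨ *-congʳ (^ᶻ-+ q≉0 r (r ℤ.* + n)) ⟨
        q ^ᶻ (r ℤ.+ r ℤ.* + n) * Vᵣ ^ᶻ y      ≡⟨ cong (λ k → q ^ᶻ k * Vᵣ ^ᶻ y) (*-suc r (+ n)) ⟨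
        q ^ᶻ (r ℤ.* + suc n) * Vᵣ ^ᶻ y        ∎)))

      Vᵣ-scaling : (q ^ᶻ (r ℤ.* + suc n) * Vᵣ ^ᶻ ℤ.pred y) ⁻¹ ≈ Vᵣ * D
      Vᵣ-scaling = ≈-trans (≈-sym (x*[x*y]⁻¹≈y⁻¹ Vᵣ≉0 (denominator-nonzero (r ℤ.* + suc n) (ℤ.pred y))))
                           (*-congˡ (⁻¹-cong (≈-trans (x∙yz≈y∙xz _ _ _) (*-congˡ (≈-sym (^ᶻ-pred Vᵣ≉0 y))))))

      collect : ∀ e V u u₋ Q D →
        (- e * (V * u - Q * u₋)) * D - (- e * u) * (V * D) ≈ e * u₋ * (Q * D)
      collect = solve 6 (λ e V u u₋ Q D →
        (:- e :* (V :* u :- Q :* u₋)) :* D :- (:- e :* u) :* (V :* D)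
          := e :* u₋ :* (Q :* D)) ≈-refl

    coefficient-suc : ∀ n j → coefficient (suc n) (suc j) ≈ coefficient n j
    coefficient-suc n j =
      *-cong (*-congˡ (reflexive (cong (λ k → w (r ℤ.* k ℤ.+ s)) (shift-index (+ n) (+ j) c))))
             (⁻¹-cong (reflexive (cong (λ k → q ^ᶻ (r ℤ.* k)) (shift-exponent (+ n) (+ j)))))
      where
      shift-index : ∀ n j c →
        + 2 ℤ.* (+ 1 ℤ.+ n) ℤ.- + 2 ℤ.* (+ 1 ℤ.+ j) ℤ.+ c ℤ.- ℤ.1ℤ ≡ + 2 ℤ.* n ℤ.- + 2 ℤ.* j ℤ.+ c ℤ.- ℤ.1ℤ
      shift-index = ℤ-Solver.solve-∀
      shift-exponent : ∀ n j → (+ 1 ℤ.+ n) ℤ.- (+ 1 ℤ.+ j) ≡ n ℤ.- j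
      shift-exponent = ℤ-Solver.solve-∀

    correction-difference : ∀ n y → correction (suc n) y - correction (suc n) (ℤ.pred y) ≈ correction n y
    correction-difference n y = begin
      correction (suc n) y - correction (suc n) (ℤ.pred y)   ≈⟨ sumℕ-sub (suc n) _ _ ⟩
      sumℕ (suc n) (λ j → term y j - term (ℤ.pred y) j)       ≈⟨ sumℕ-suc-first n _ ⟩
      (term y 0 - term (ℤ.pred y) 0)
        + sumℕ n (λ j → term y (suc j) - term (ℤ.pred y) (suc j)) ≈⟨ +-cong (-‿inverseʳ _) (sumℕ-cong n term-difference) ⟩
      0# + correction n y                                     ≈⟨ +-identityˡ _ ⟩
      correction n y                                          ∎
      where
      term : ℤ → ℕ → Carrier
      term x j = coefficient (suc n) j * fromℤ (binomℤ (x ℤ.+ + j ℤ.- c) j)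

      suc-index : ∀ y j c → y ℤ.+ (+ 1 ℤ.+ j) ℤ.- c ≡ + 1 ℤ.+ (y ℤ.+ j ℤ.- c)
      suc-index = ℤ-Solver.solve-∀
      pred-index : ∀ y j c → (ℤ.-1ℤ ℤ.+ y) ℤ.+ (+ 1 ℤ.+ j) ℤ.- c ≡ y ℤ.+ j ℤ.- c
      pred-index = ℤ-Solver.solve-∀
      x+y-x≡y : ∀ x y → x ℤ.+ y ℤ.- x ≡ y
      x+y-x≡y = ℤ-Solver.solve-∀

      term-difference : ∀ j → term y (suc j) - term (ℤ.pred y) (suc j)
                              ≈ coefficient n j * fromℤ (binomℤ (y ℤ.+ + j ℤ.- c) j)
      term-difference j = begin
        coefficient (suc n) (suc j) * fromℤ B₊ - coefficient (suc n) (suc j) * fromℤ B₀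
          ≈⟨ x[y-z]≈xy-xz _ _ _ ⟨
        coefficient (suc n) (suc j) * (fromℤ B₊ - fromℤ B₀)
          ≈⟨ *-cong (coefficient-suc n j) (≈-sym (≈-trans (fromℤ-+ B₊ (ℤ.- B₀)) (+-congˡ (fromℤ-neg B₀)))) ⟩
        coefficient n j * fromℤ (B₊ ℤ.- B₀)
          ≡⟨ cong (λ B → coefficient n j * fromℤ B) pascal ⟩
        coefficient n j * fromℤ (binomℤ N j) ∎
        where
        N  = y ℤ.+ + j ℤ.- c
        B₊ = binomℤ (y ℤ.+ + suc j ℤ.- c) (suc j)
        B₀ = binomℤ (ℤ.pred y ℤ.+ + suc j ℤ.- c) (suc j)
        pascal : B₊ ℤ.- B₀ ≡ binomℤ N j
        pascal = trans (cong₂ (λ M M′ → binomℤ M (suc j) ℤ.- binomℤ M′ (suc j)) (suc-index y (+ j) c) (pred-index y (+ j) c))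
                       (trans (cong (ℤ._- binomℤ N (suc j)) (binomℤ-pascal N j)) (x+y-x≡y (binomℤ N (suc j)) (binomℤ N j)))

    closedForm-difference : ∀ n y → closedForm (suc n) y - closedForm (suc n) (ℤ.pred y) ≈ closedForm n y
    closedForm-difference n y =
      ≈-trans (regroup _ _ _ _ _) (+-cong (leading-difference n y) (-‿cong (*-congˡ (correction-difference n y))))
      where
      regroup : ∀ A C A′ C′ K → (A - K * C) - (A′ - K * C′) ≈ (A - A′) - K * (C - C′)
      regroup = solve 5 (λ A C A′ C′ K → (A :- K :* C) :- (A′ :- K :* C′) := (A :- A′) :- K :* (C :- C′)) ≈-refl

    closedForm-vanishes : ∀ n → closedForm (suc n) (ℤ.pred c) ≈ 0#
    closedForm-vanishes n = begin
      leading (suc n) (ℤ.pred c) - 1# / P * correction (suc n) (ℤ.pred c)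
        ≈⟨ +-cong leading-at-c-1 (-‿cong (*-cong (*-identityˡ _) correction-at-c-1)) ⟩
      e * u * (Q ⁻¹ * P ⁻¹) - P ⁻¹ * (e * u * Q ⁻¹)
        ≈⟨ cancel _ _ _ _ ⟩
      0# ∎
      where
      e = (- 1#) ^ⁿ suc n
      u = w (r ℤ.* (ℤ.pred c ℤ.+ + 2 ℤ.* + suc n) ℤ.+ s)
      Q = q ^ᶻ (r ℤ.* + suc n)
      P = Vᵣ ^ᶻ (c ℤ.- ℤ.1ℤ)

      pred≡-1 : ∀ c → ℤ.-1ℤ ℤ.+ c ≡ c ℤ.- ℤ.1ℤ
      pred≡-1 = ℤ-Solver.solve-∀
      c-1-index : ∀ r c n s → r ℤ.* ((ℤ.-1ℤ ℤ.+ c) ℤ.+ + 2 ℤ.* n) ℤ.+ s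
                                ≡ r ℤ.* (+ 2 ℤ.* n ℤ.- + 2 ℤ.* + 0 ℤ.+ c ℤ.- ℤ.1ℤ) ℤ.+ s
      c-1-index = ℤ-Solver.solve-∀
      c-1-binomial : ∀ c j → (ℤ.-1ℤ ℤ.+ c) ℤ.+ (+ 1 ℤ.+ j) ℤ.- c ≡ j
      c-1-binomial = ℤ-Solver.solve-∀

      leading-at-c-1 : leading (suc n) (ℤ.pred c) ≈ e * u * (Q ⁻¹ * P ⁻¹)
      leading-at-c-1 = *-congˡ (≈-trans (⁻¹-cong (*-congˡ (reflexive (cong (Vᵣ ^ᶻ_) (pred≡-1 c)))))
                                        (⁻¹-distrib-* (^ᶻ-nonzero q≉0 (r ℤ.* + suc n)) (^ᶻ-nonzero Vᵣ≉0 (c ℤ.- ℤ.1ℤ))))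

      higher-terms-vanish : ∀ j → coefficient (suc n) (suc j) * fromℤ (binomℤ (ℤ.pred c ℤ.+ + suc j ℤ.- c) (suc j)) ≈ 0#
      higher-terms-vanish j = ≈-trans (*-congˡ (reflexive (cong fromℤ
        (trans (cong (λ N → binomℤ N (suc j)) (c-1-binomial c (+ j))) (binomℤ-vanishes j))))) (zeroʳ _)

      correction-at-c-1 : correction (suc n) (ℤ.pred c) ≈ e * u * Q ⁻¹
      correction-at-c-1 = begin
        correction (suc n) (ℤ.pred c)         ≈⟨ sumℕ-suc-first n _ ⟩
        coefficient (suc n) 0 * (1# + 0#) + _ ≈⟨ +-cong (*-cong first-coefficient (+-identityʳ 1#)) (sumℕ-zero n higher-terms-vanish) ⟩
        e * u * Q ⁻¹ * 1# + 0#                ≈⟨ +-identityʳ _ ⟩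
        e * u * Q ⁻¹ * 1#                     ≈⟨ *-identityʳ _ ⟩
        e * u * Q ⁻¹                          ∎
        where
        first-coefficient : coefficient (suc n) 0 ≈ e * u * Q ⁻¹
        first-coefficient = *-cong (*-congˡ (reflexive (cong w (sym (c-1-index r c (+ suc n) s)))))
                                   (⁻¹-cong (reflexive (cong (q ^ᶻ_) (cong (r ℤ.*_) (ℤ.+-identityʳ (+ suc n))))))

      cancel : ∀ e u Q⁻¹ P⁻¹ → e * u * (Q⁻¹ * P⁻¹) - P⁻¹ * (e * u * Q⁻¹) ≈ 0#
      cancel = solve 4 (λ e u Q⁻¹ P⁻¹ → e :* u :* (Q⁻¹ :* P⁻¹) :- P⁻¹ :* (e :* u :* Q⁻¹) := con (+ 0)) ≈-refl

    closedForm-zero : ∀ x → summand x ≈ closedForm 0 x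
    closedForm-zero x = ≈-sym (begin
      leading 0 x - 1# / (Vᵣ ^ᶻ (c ℤ.- ℤ.1ℤ)) * 0#        ≈⟨ +-congˡ (≈-trans (-‿cong (zeroʳ _)) ε⁻¹≈ε) ⟩
      leading 0 x + 0#                                    ≈⟨ +-identityʳ _ ⟩
      1# * w (r ℤ.* (x ℤ.+ + 0) ℤ.+ s) * (q ^ᶻ (r ℤ.* + 0) * Vᵣ ^ᶻ x) ⁻¹
        ≈⟨ *-cong (≈-trans (*-identityˡ _) (reflexive (cong (λ k → w (r ℤ.* k ℤ.+ s)) (ℤ.+-identityʳ x))))
                  (⁻¹-cong (≈-trans (*-congʳ (reflexive (cong (q ^ᶻ_) (ℤ.*-zeroʳ r)))) (*-identityˡ _))) ⟩
      summand x                                           ∎)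

    iterSum-closedForm : ∀ n x → iterSum c n summand x ≈ closedForm n x
    iterSum-closedForm zero    x = closedForm-zero x
    iterSum-closedForm (suc n) x = begin
      sumℤ c x (iterSum c n summand)
        ≈⟨ sumℤ-cong c x (λ y → ≈-trans (iterSum-closedForm n y) (≈-sym (closedForm-difference n y))) ⟩
      sumℤ c x (λ y → closedForm (suc n) y - closedForm (suc n) (ℤ.pred y))
        ≈⟨ sumℤ-telescope (closedForm (suc n)) c x ⟩
      closedForm (suc n) x - closedForm (suc n) (ℤ.pred c)
        ≈⟨ +-congˡ (≈-trans (-‿cong (closedForm-vanishes n)) ε⁻¹≈ε) ⟩
      closedForm (suc n) x + 0#
        ≈⟨ +-identityʳ _ ⟩
      closedForm (suc n) x ∎

theorem3 : ∀ {ℓ₁ ℓ₂} (F : Field ℓ₁ ℓ₂) → let open Field F in let open FieldDefs F in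
    (a b p q : Carrier) → ¬ (p ≈ 0#) → ¬ (q ≈ 0#) →
    (r s c aₙ : ℤ) → ¬ (V p q r ≈ 0#) → (n : ℕ) → n ≥ 1 →
    iterSum c n (λ a₀ → W a b p q (r ℤ.* a₀ ℤ.+ s) / (V p q r ^ᶻ a₀)) aₙ
      ≈ ((- 1#) ^ⁿ n * W a b p q (r ℤ.* (aₙ ℤ.+ + 2 ℤ.* + n) ℤ.+ s)
           / (q ^ᶻ (r ℤ.* + n) * (V p q r ^ᶻ aₙ))
         - (1# / (V p q r ^ᶻ (c ℤ.- ℤ.1ℤ)))
           * sumℕ n (λ j → (- 1#) ^ⁿ (n ∸ j)
               * W a b p q (r ℤ.* (+ 2 ℤ.* + n ℤ.- + 2 ℤ.* + j ℤ.+ c ℤ.- ℤ.1ℤ) ℤ.+ s)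
               / (q ^ᶻ (r ℤ.* (+ n ℤ.- + j)))
               * fromℤ (binomℤ (aₙ ℤ.+ + j ℤ.- c) j)))
theorem3 F a b p q _ q≉0 r s c aₙ Vᵣ≉0 n _ = ClosedForm.iterSum-closedForm F a b p q q≉0 r s c Vᵣ≉0 n aₙ
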